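{- Let $X=\{X_1,X_2\}$ be a $\lambda_2$-equitable $2$-partition of $J(n,3)$ with quotient matrix $(p_{ij})$ satisfying $p_{11}\geq p_{22}$ and $p_{11}\geq 2n-7$, and assume no vertex is of type (I) or (II). Let $\{a,b,c\}$ be a vertex with $\overline{abc}=1$ and suppose there are pairwise distinct $d,e,f\in[n]\setminus\{a,b,c\}$ with $(\overline{abd},\overline{acd},\overline{bcd})=(1,1,0)$, $(\overline{abe},\overline{ace},\overline{bce})=(1,0,1)$, $(\overline{abf},\overline{acf},\overline{bcf})=(0,1,1)$, and for every $g\in[n]\setminus\{a,b,c,d,e,f\}$ the triple $(\overline{abg},\overline{acg},\overline{bcg})$ is $(1,1,1)$ or $(0,0,0)$. Then $n\leq 8$.
   Context: $J(n,3)$: vertices are the $3$-subsets of $[n]$, adjacent iff they share exactly two elements; it is $3(n-3)$-regular. An equitable $2$-partition with quotient matrix $(p_{ij})$ means each vertex of $X_i$ has exactly $p_{ij}$ neighbours in $X_j$; $\lambda_2$-equitable means $p_{11}-p_{21}=n-7$. $\overline{u}=1$ if $u\in X_1$, else $0$; $\overline{xyz}=\overline{\{x,y,z\}}$; $\overline{ij\ast}$ is the number of $3$-subsets containing $i,j$ lying in $X_1$. A vertex $v=\{x,y,z\}\in X_1$, labelled so that $\overline{xy\ast}\geq\overline{xz\ast}\geq\overline{yz\ast}$, is of type (I) if $(\overline{xy\ast}-\overline{xz\ast},\overline{xz\ast}-\overline{yz\ast})=(n-4,0)$ and of type (II) if this pair equals $((n-4)/2,(n-4)/2)$. -}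

module Defs where

open import Data.Bool using (Bool; true; false; _∧_; not)
open import Data.Nat using (ℕ; zero; suc; _≟_; _≤_)
open import Data.Fin using (Fin)
open import Data.Vec using (Vec; []; _∷_; lookup)
open import Data.List using (List; []; _∷_; map; _++_; filter)
open import Data.Fin.Subset using (Subset; inside; outside; ⁅_⁆; _∪_; _∩_; ∣_∣)
open import Data.Integer as ℤ using (ℤ; +_; _-_; _*_)
open import Data.Product using (_×_; ∃)
open import Relation.Binary.PropositionalEquality using (_≡_; _≢_)
open import Relation.Nullary.Decidable using (⌊_⌋)

count : {A : Set} → (A → Bool) → List A → ℕ
count p [] = 0
count p (x ∷ xs) with p x
... | true  = suc (count p xs)
... | false = count p xs

allSubsets : (n : ℕ) → List (Subset n)
allSubsets zero = [] ∷ []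
allSubsets (suc n) = map (outside ∷_) (allSubsets n) ++ map (inside ∷_) (allSubsets n)

vertices : (n : ℕ) → List (Subset n)
vertices n = filter (λ s → ∣ s ∣ ≟ 3) (allSubsets n)

adjacent : {n : ℕ} → Subset n → Subset n → Bool
adjacent u v = ⌊ ∣ u ∩ v ∣ ≟ 2 ⌋

-- A 2-partition {X₁, X₂} of V(J(n,3)) is encoded by its indicator
-- col : Subset n → Bool, with col v = true iff v ∈ X₁ (so v ∈ X₂ iff col v = false).
-- Thus col v is exactly  \overline{v}.
Colouring : ℕ → Set
Colouring n = Subset n → Bool

nbrs₁ : {n : ℕ} → Colouring n → Subset n → ℕ
nbrs₁ {n} col v = count (λ u → adjacent u v ∧ col u) (vertices n)

nbrs₂ : {n : ℕ} → Colouring n → Subset n → ℕ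
nbrs₂ {n} col v = count (λ u → adjacent u v ∧ not (col u)) (vertices n)

record Equitable {n : ℕ} (col : Colouring n) (p11 p12 p21 p22 : ℕ) : Set where
  field
    X₁-nonempty : ∃ λ v → ∣ v ∣ ≡ 3 × col v ≡ true
    X₂-nonempty : ∃ λ v → ∣ v ∣ ≡ 3 × col v ≡ false
    row₁ : ∀ v → ∣ v ∣ ≡ 3 → col v ≡ true  → nbrs₁ col v ≡ p11 × nbrs₂ col v ≡ p12
    row₂ : ∀ v → ∣ v ∣ ≡ 3 → col v ≡ false → nbrs₁ col v ≡ p21 × nbrs₂ col v ≡ p22

LambdaTwo : (n p11 p21 : ℕ) → Set
LambdaTwo n p11 p21 = (+ p11) - (+ p21) ≡ (+ n) - (+ 7)

bar : {n : ℕ} → Colouring n → Fin n → Fin n → Fin n → Bool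
bar col x y z = col (⁅ x ⁆ ∪ ⁅ y ⁆ ∪ ⁅ z ⁆)

barPair : {n : ℕ} → Colouring n → Fin n → Fin n → ℕ
barPair {n} col i j = count (λ s → lookup s i ∧ lookup s j ∧ col s) (vertices n)

Distinct3 : {n : ℕ} → Fin n → Fin n → Fin n → Set
Distinct3 x y z = x ≢ y × x ≢ z × y ≢ z

TypeI : {n : ℕ} → Colouring n → Fin n → Fin n → Fin n → Set
TypeI {n} col x y z =
  Distinct3 x y z × bar col x y z ≡ true ×
  barPair col x z ≤ barPair col x y × barPair col y z ≤ barPair col x z ×
  (+ barPair col x y) - (+ barPair col x z) ≡ (+ n) - (+ 4) ×
  (+ barPair col x z) - (+ barPair col y z) ≡ + 0

-- ... or equal to ((n-4)/2, (n-4)/2)  [type (II)]; written as 2·diff = n - 4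
TypeII : {n : ℕ} → Colouring n → Fin n → Fin n → Fin n → Set
TypeII {n} col x y z =
  Distinct3 x y z × bar col x y z ≡ true ×
  barPair col x z ≤ barPair col x y × barPair col y z ≤ barPair col x z ×
  (+ 2) * ((+ barPair col x y) - (+ barPair col x z)) ≡ (+ n) - (+ 4) ×
  (+ 2) * ((+ barPair col x z) - (+ barPair col y z)) ≡ (+ n) - (+ 4)

-- Counting the 3-subsets through a pair gives xy∗ = Σ_{g ∉ {x,y}} \overline{xyg}, and counting
-- the X₁-neighbours of v = {x,y,z} gives the row sums p11 + 3 = xy∗ + xz∗ + yz∗ if v ∈ X₁ and
-- p21 = xy∗ + xz∗ + yz∗ if v ∈ X₂.  By the hypotheses on d, e, f the summands of ab∗, ac∗ and bc∗ agree
-- except at two points each, with the same total there, so ab∗ = ac∗ = bc∗.  The row sums of abc, abd,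
-- acd ∈ X₁ and bcd ∈ X₂, together with p11 − p21 = n − 7, give 2 p11 + 3n + 6 = 6 (ad∗ + 2); since at most
-- n − 2 triples contain {a,d} and 2n − 7 ≤ p11, this forces 7n + 6 ≤ 6n + 14.
module Submission where

open import Defs
open import Data.Bool using (Bool; true; false; _∧_; _∨_; not; T)
import Data.Bool.Properties as Boolₚ
open import Data.Empty using (⊥-elim)
open import Data.Nat using (ℕ; zero; suc; _+_; _*_; _≤_; _≥_; _≡ᵇ_; z≤n; s≤s; _≟_)
open import Data.Nat.Properties as ℕ
  using (+-identityʳ; +-comm; +-cancelʳ-≡; +-0-commutativeMonoid)
open import Data.Nat.ListAction using (sum)
open import Data.Nat.ListAction.Properties using (sum-++)
open import Data.Nat.Tactic.RingSolver using (solve-∀)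
open import Data.Integer as ℤ using (+_; _-_) renaming (_+_ to _⊕_)
import Data.Integer.Properties as ℤP
open import Data.Integer.Tactic.RingSolver using () renaming (solve-∀ to ℤ-solve-∀)
open import Data.Fin using (Fin; zero; suc) renaming (_≟_ to _≟ᶠ_)
open import Data.Fin.Subset using (Subset; inside; outside; ⁅_⁆; _∪_; _∩_; ∣_∣; ⊥; ⊤)
open import Data.Fin.Subset.Properties using (∪-identityˡ; ∪-identityʳ; ∪-assoc; ∪-comm; ∩-identityˡ; ∣⁅x⁆∣≡1)
open import Data.List using (List; []; _∷_; map; _++_; filter)
open import Data.List.Properties using (map-++; map-cong; map-∘)
open import Data.Vec using ([]; _∷_; lookup)
open import Data.Vec.Properties using (lookup-zipWith; lookup-replicate)
open import Data.Product using (_×_; _,_; proj₁)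
open import Data.Sum using (_⊎_; inj₁; inj₂)
open import Function using (_∘_)
open import Relation.Binary.PropositionalEquality
open import Relation.Nullary using (¬_; Dec; does; yes; no)
open import Relation.Nullary.Decidable using (dec-true; dec-false; isYes≗does)
open import Algebra.Properties.CommutativeMonoid.Sum +-0-commutativeMonoid
  using (sum-syntax; sum-cong-≗; ∑-distrib-+; sum-replicate-zero)
  renaming (sum to ∑)

𝟙 : Bool → ℕ
𝟙 true  = 1
𝟙 false = 0

𝟙-∨-disjoint : (α β : Bool) → (α ≡ true → β ≡ false) → 𝟙 (α ∨ β) ≡ 𝟙 α + 𝟙 β
𝟙-∨-disjoint true  true  α⇒¬β with () ← α⇒¬β refl
𝟙-∨-disjoint true  false _    = refl
𝟙-∨-disjoint false β     _    = refl

𝟙-partition : (α β : Bool) → (α ≡ true → β ≡ false) → 𝟙 (not (α ∨ β)) + 𝟙 α + 𝟙 β ≡ 1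
𝟙-partition true  true  α⇒¬β with () ← α⇒¬β refl
𝟙-partition true  false _    = refl
𝟙-partition false true  _    = refl
𝟙-partition false false _    = refl

𝟙*𝟙≤𝟙 : (α β : Bool) → 𝟙 α * 𝟙 β ≤ 𝟙 α
𝟙*𝟙≤𝟙 true  true  = ℕ.≤-refl
𝟙*𝟙≤𝟙 true  false = z≤n
𝟙*𝟙≤𝟙 false β     = z≤n

𝟙-∧ : (α β : Bool) → 𝟙 (α ∧ β) ≡ 𝟙 α * 𝟙 β
𝟙-∧ true  true  = refl
𝟙-∧ true  false = refl
𝟙-∧ false β     = refl

∑ᴸ : {A : Set} → (A → ℕ) → List A → ℕ
∑ᴸ f xs = sum (map f xs)

module _ {A : Set} where

  count≡∑ᴸ : (p : A → Bool) (xs : List A) → count p xs ≡ ∑ᴸ (𝟙 ∘ p) xs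
  count≡∑ᴸ p [] = refl
  count≡∑ᴸ p (x ∷ xs) with p x
  ... | true  = cong suc (count≡∑ᴸ p xs)
  ... | false = count≡∑ᴸ p xs

  ∑ᴸ-cong : {f g : A → ℕ} (xs : List A) → (∀ x → f x ≡ g x) → ∑ᴸ f xs ≡ ∑ᴸ g xs
  ∑ᴸ-cong xs f≗g = cong sum (map-cong f≗g xs)

  ∑ᴸ-zero : (xs : List A) → ∑ᴸ (λ _ → 0) xs ≡ 0
  ∑ᴸ-zero []       = refl
  ∑ᴸ-zero (_ ∷ xs) = ∑ᴸ-zero xs

  ∑ᴸ-distrib-+ : (f g : A → ℕ) (xs : List A) → ∑ᴸ (λ x → f x + g x) xs ≡ ∑ᴸ f xs + ∑ᴸ g xs
  ∑ᴸ-distrib-+ f g []       = refl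
  ∑ᴸ-distrib-+ f g (x ∷ xs) rewrite ∑ᴸ-distrib-+ f g xs = interchange (f x) (g x) (∑ᴸ f xs) (∑ᴸ g xs)
    where
    interchange : ∀ a b c d → (a + b) + (c + d) ≡ (a + c) + (b + d)
    interchange = solve-∀

  ∑ᴸ-++ : (f : A → ℕ) (xs ys : List A) → ∑ᴸ f (xs ++ ys) ≡ ∑ᴸ f xs + ∑ᴸ f ys
  ∑ᴸ-++ f xs ys = trans (cong sum (map-++ f xs ys)) (sum-++ (map f xs) (map f ys))

  ∑ᴸ-filter : {P : A → Set} (P? : ∀ x → Dec (P x)) (f : A → ℕ) (xs : List A) →
    ∑ᴸ f (filter P? xs) ≡ ∑ᴸ (λ x → 𝟙 (does (P? x)) * f x) xs
  ∑ᴸ-filter P? f []       = refl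
  ∑ᴸ-filter P? f (x ∷ xs) with does (P? x)
  ... | true  = cong₂ _+_ (sym (+-identityʳ (f x))) (∑ᴸ-filter P? f xs)
  ... | false = ∑ᴸ-filter P? f xs

  ∑ᴸ-*ˡ : (k : ℕ) (f : A → ℕ) (xs : List A) → ∑ᴸ (λ x → k * f x) xs ≡ k * ∑ᴸ f xs
  ∑ᴸ-*ˡ k f []       = sym (ℕ.*-zeroʳ k)
  ∑ᴸ-*ˡ k f (x ∷ xs) rewrite ∑ᴸ-*ˡ k f xs = sym (ℕ.*-distribˡ-+ k (f x) (∑ᴸ f xs))

∑ᴸ-map : {A B : Set} (f : B → ℕ) (g : A → B) (xs : List A) → ∑ᴸ f (map g xs) ≡ ∑ᴸ (f ∘ g) xs
∑ᴸ-map f g xs = cong sum (sym (map-∘ xs))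

∑ˢ : (n : ℕ) → (Subset n → ℕ) → ℕ
∑ˢ n f = ∑ᴸ f (allSubsets n)

∑ˢ-suc : (n : ℕ) (f : Subset (suc n) → ℕ) →
  ∑ˢ (suc n) f ≡ ∑ˢ n (λ s → f (outside ∷ s)) + ∑ˢ n (λ s → f (inside ∷ s))
∑ˢ-suc n f = begin
  ∑ᴸ f (map (outside ∷_) (allSubsets n) ++ map (inside ∷_) (allSubsets n))
    ≡⟨ ∑ᴸ-++ f (map (outside ∷_) (allSubsets n)) _ ⟩
  ∑ᴸ f (map (outside ∷_) (allSubsets n)) + ∑ᴸ f (map (inside ∷_) (allSubsets n))
    ≡⟨ cong₂ _+_ (∑ᴸ-map f _ (allSubsets n)) (∑ᴸ-map f _ (allSubsets n)) ⟩
  ∑ˢ n (λ s → f (outside ∷ s)) + ∑ˢ n (λ s → f (inside ∷ s)) ∎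
  where open ≡-Reasoning

infix 5 _⊆ᵇ_

_⊆ᵇ_ : {n : ℕ} → Subset n → Subset n → Bool
[]      ⊆ᵇ []      = true
(r ∷ R) ⊆ᵇ (x ∷ s) = (not r ∨ x) ∧ (R ⊆ᵇ s)

⊆ᵇ⇒∣∣≤ : {n : ℕ} (R s : Subset n) → R ⊆ᵇ s ≡ true → ∣ R ∣ ≤ ∣ s ∣
⊆ᵇ⇒∣∣≤ []          []          _   = z≤n
⊆ᵇ⇒∣∣≤ (inside ∷ R)  (inside ∷ s)  R⊆s = s≤s (⊆ᵇ⇒∣∣≤ R s R⊆s)
⊆ᵇ⇒∣∣≤ (outside ∷ R) (inside ∷ s)  R⊆s = ℕ.m≤n⇒m≤1+n (⊆ᵇ⇒∣∣≤ R s R⊆s)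
⊆ᵇ⇒∣∣≤ (outside ∷ R) (outside ∷ s) R⊆s = ⊆ᵇ⇒∣∣≤ R s R⊆s

no-superset-one-smaller : {n : ℕ} (R s : Subset n) (v : ℕ) →
  𝟙 ((R ⊆ᵇ s) ∧ (suc ∣ s ∣ ≡ᵇ ∣ R ∣)) * v ≡ 0
no-superset-one-smaller R s v with R ⊆ᵇ s in R⊆s
... | false = refl
... | true with suc ∣ s ∣ ≡ᵇ ∣ R ∣ in eq
...   | false = refl
...   | true  = ⊥-elim (ℕ.1+n≰n (subst (_≤ ∣ s ∣) (sym 1+∣s∣≡∣R∣) (⊆ᵇ⇒∣∣≤ R s R⊆s)))
  where
  1+∣s∣≡∣R∣ : suc ∣ s ∣ ≡ ∣ R ∣
  1+∣s∣≡∣R∣ = ℕ.≡ᵇ⇒≡ (suc ∣ s ∣) ∣ R ∣ (subst T (sym eq) _)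

∑ˢ-⊇-sameSize : (n : ℕ) (R : Subset n) (f : Subset n → ℕ) →
  ∑ˢ n (λ s → 𝟙 ((R ⊆ᵇ s) ∧ (∣ s ∣ ≡ᵇ ∣ R ∣)) * f s) ≡ f R
∑ˢ-⊇-sameSize zero    []          f = trans (+-identityʳ _) (+-identityʳ (f []))
∑ˢ-⊇-sameSize (suc n) (inside ∷ R) f =
  trans (∑ˢ-suc n _) (cong₂ _+_ (∑ᴸ-zero (allSubsets n)) (∑ˢ-⊇-sameSize n R (λ s → f (inside ∷ s))))
∑ˢ-⊇-sameSize (suc n) (outside ∷ R) f =
  trans (∑ˢ-suc n _) (trans
    (cong₂ _+_ (∑ˢ-⊇-sameSize n R (λ s → f (outside ∷ s)))
               (trans (∑ᴸ-cong (allSubsets n) (λ s → no-superset-one-smaller R s (f (inside ∷ s))))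
                      (∑ᴸ-zero (allSubsets n))))
    (+-identityʳ (f (outside ∷ R))))

∑ˢ-⊇-oneLarger : (n : ℕ) (R : Subset n) (f : Subset n → ℕ) →
  ∑ˢ n (λ s → 𝟙 ((R ⊆ᵇ s) ∧ (∣ s ∣ ≡ᵇ suc ∣ R ∣)) * f s) ≡
  ∑[ g < n ] (𝟙 (not (lookup R g)) * f (R ∪ ⁅ g ⁆))
∑ˢ-⊇-oneLarger zero    []           f = refl
∑ˢ-⊇-oneLarger (suc n) (inside ∷ R) f =
  trans (∑ˢ-suc n _) (cong₂ _+_ (∑ᴸ-zero (allSubsets n)) (∑ˢ-⊇-oneLarger n R (λ s → f (inside ∷ s))))
∑ˢ-⊇-oneLarger (suc n) (outside ∷ R) f =
  trans (∑ˢ-suc n _) (trans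
    (cong₂ _+_ (∑ˢ-⊇-oneLarger n R (λ s → f (outside ∷ s))) (∑ˢ-⊇-sameSize n R (λ s → f (inside ∷ s))))
    (trans (+-comm rest _) (cong (_+ rest) (sym f[R∪⊥]+0≡f[R]))))
  where
  rest : ℕ
  rest = ∑[ g < n ] (𝟙 (not (lookup R g)) * f (outside ∷ R ∪ ⁅ g ⁆))
  f[R∪⊥]+0≡f[R] : f (inside ∷ R ∪ ⊥) + 0 ≡ f (inside ∷ R)
  f[R∪⊥]+0≡f[R] = trans (+-identityʳ _) (cong (λ t → f (inside ∷ t)) (∪-identityʳ R))

δ : {n : ℕ} → Fin n → Fin n → ℕ
δ i g = 𝟙 (does (i ≟ᶠ g))

δ-exclusive : {n : ℕ} {x y : Fin n} → x ≢ y → ∀ g → does (x ≟ᶠ g) ≡ true → does (y ≟ᶠ g) ≡ false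
δ-exclusive {x = x} {y} x≢y g x≡ᵇg with x ≟ᶠ g
... | yes refl = dec-false (y ≟ᶠ x) (x≢y ∘ sym)

∑-δ : (n : ℕ) (i : Fin n) (h : Fin n → ℕ) → ∑[ g < n ] (δ i g * h g) ≡ h i
∑-δ (suc n) zero    h =
  trans (cong (λ t → h zero + 0 + t) (sum-replicate-zero n)) (trans (+-identityʳ _) (+-identityʳ (h zero)))
∑-δ (suc n) (suc i) h = ∑-δ n i (h ∘ suc)

∑-δ-one : (n : ℕ) (i : Fin n) → ∑ (δ i) ≡ 1
∑-δ-one n i = trans (sum-cong-≗ {n} (λ g → sym (ℕ.*-identityʳ (δ i g)))) (∑-δ n i (λ _ → 1))

∑-const-one : (n : ℕ) → ∑[ g < n ] 1 ≡ n
∑-const-one zero    = refl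
∑-const-one (suc n) = cong suc (∑-const-one n)

∑-mono-≤ : (n : ℕ) {f g : Fin n → ℕ} → (∀ i → f i ≤ g i) → ∑ f ≤ ∑ g
∑-mono-≤ zero    f≤g = z≤n
∑-mono-≤ (suc n) f≤g = ℕ.+-mono-≤ (f≤g zero) (∑-mono-≤ n (f≤g ∘ suc))

∣∣≡∑ : {n : ℕ} (t : Subset n) → ∣ t ∣ ≡ ∑[ g < n ] 𝟙 (lookup t g)
∣∣≡∑ []            = refl
∣∣≡∑ (inside ∷ t)  = cong suc (∣∣≡∑ t)
∣∣≡∑ (outside ∷ t) = ∣∣≡∑ t

lookup-⁅⁆ : {n : ℕ} (i g : Fin n) → lookup ⁅ i ⁆ g ≡ does (i ≟ᶠ g)
lookup-⁅⁆ zero    zero    = refl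
lookup-⁅⁆ zero    (suc g) = lookup-replicate g outside
lookup-⁅⁆ (suc i) zero    = refl
lookup-⁅⁆ (suc i) (suc g) = lookup-⁅⁆ i g

⊆ᵇ-∪ : {n : ℕ} (A B s : Subset n) → (A ∪ B) ⊆ᵇ s ≡ (A ⊆ᵇ s) ∧ (B ⊆ᵇ s)
⊆ᵇ-∪ []      []      []      = refl
⊆ᵇ-∪ (a ∷ A) (b ∷ B) (x ∷ s) rewrite ⊆ᵇ-∪ A B s = head-step a b x (A ⊆ᵇ s) (B ⊆ᵇ s)
  where
  head-step : ∀ a b x u v → (not (a ∨ b) ∨ x) ∧ (u ∧ v) ≡ ((not a ∨ x) ∧ u) ∧ ((not b ∨ x) ∧ v)
  head-step false false x     u v = refl
  head-step true  b     false u v = refl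
  head-step false true  false u v = sym (Boolₚ.∧-zeroʳ u)
  head-step true  true  true  u v = refl
  head-step true  false true  u v = refl
  head-step false true  true  u v = refl

⁅⁆-⊆ᵇ : {n : ℕ} (i : Fin n) (s : Subset n) → ⁅ i ⁆ ⊆ᵇ s ≡ lookup s i
⁅⁆-⊆ᵇ zero    (x ∷ s) = trans (cong (x ∧_) (⊥-⊆ᵇ s)) (Boolₚ.∧-identityʳ x)
  where
  ⊥-⊆ᵇ : {n : ℕ} (s : Subset n) → ⊥ ⊆ᵇ s ≡ true
  ⊥-⊆ᵇ []      = refl
  ⊥-⊆ᵇ (_ ∷ s) = ⊥-⊆ᵇ s
⁅⁆-⊆ᵇ (suc i) (_ ∷ s) = ⁅⁆-⊆ᵇ i s

∣⁅i⁆∪⁅j⁆∣≡2 : {n : ℕ} (i j : Fin n) → i ≢ j → ∣ ⁅ i ⁆ ∪ ⁅ j ⁆ ∣ ≡ 2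
∣⁅i⁆∪⁅j⁆∣≡2 zero    zero    i≢j = ⊥-elim (i≢j refl)
∣⁅i⁆∪⁅j⁆∣≡2 zero    (suc j) _   = cong suc (trans (cong ∣_∣ (∪-identityˡ ⁅ j ⁆)) (∣⁅x⁆∣≡1 j))
∣⁅i⁆∪⁅j⁆∣≡2 (suc i) zero    _   = cong suc (trans (cong ∣_∣ (∪-identityʳ ⁅ i ⁆)) (∣⁅x⁆∣≡1 i))
∣⁅i⁆∪⁅j⁆∣≡2 (suc i) (suc j) i≢j = ∣⁅i⁆∪⁅j⁆∣≡2 i j (i≢j ∘ cong suc)

count-triples-through-pair : (n : ℕ) (i j : Fin n) → i ≢ j → (p : Subset n → Bool) →
  count (λ s → lookup s i ∧ lookup s j ∧ p s) (vertices n) ≡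
  ∑[ g < n ] (𝟙 (not (does (i ≟ᶠ g) ∨ does (j ≟ᶠ g))) * 𝟙 (p (⁅ i ⁆ ∪ ⁅ j ⁆ ∪ ⁅ g ⁆)))
count-triples-through-pair n i j i≢j p = begin
  count (λ s → lookup s i ∧ lookup s j ∧ p s) (vertices n)
    ≡⟨ count≡∑ᴸ _ (vertices n) ⟩
  ∑ᴸ (λ s → 𝟙 (lookup s i ∧ lookup s j ∧ p s)) (vertices n)
    ≡⟨ ∑ᴸ-filter (λ s → ∣ s ∣ ≟ 3) _ (allSubsets n) ⟩
  ∑ˢ n (λ s → 𝟙 (∣ s ∣ ≡ᵇ 3) * 𝟙 (lookup s i ∧ lookup s j ∧ p s))
    ≡⟨ ∑ᴸ-cong (allSubsets n) rearrange ⟩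
  ∑ˢ n (λ s → 𝟙 ((R ⊆ᵇ s) ∧ (∣ s ∣ ≡ᵇ suc ∣ R ∣)) * 𝟙 (p s))
    ≡⟨ ∑ˢ-⊇-oneLarger n R (𝟙 ∘ p) ⟩
  ∑[ g < n ] (𝟙 (not (lookup R g)) * 𝟙 (p (R ∪ ⁅ g ⁆)))
    ≡⟨ sum-cong-≗ {n} (λ g → cong₂ (λ u w → 𝟙 (not u) * 𝟙 (p w)) (lookup-pair g) (∪-assoc ⁅ i ⁆ ⁅ j ⁆ ⁅ g ⁆)) ⟩
  ∑[ g < n ] (𝟙 (not (does (i ≟ᶠ g) ∨ does (j ≟ᶠ g))) * 𝟙 (p (⁅ i ⁆ ∪ ⁅ j ⁆ ∪ ⁅ g ⁆))) ∎
  where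
  open ≡-Reasoning
  R : Subset n
  R = ⁅ i ⁆ ∪ ⁅ j ⁆
  lookup-pair : ∀ g → lookup R g ≡ does (i ≟ᶠ g) ∨ does (j ≟ᶠ g)
  lookup-pair g = trans (lookup-zipWith _∨_ g ⁅ i ⁆ ⁅ j ⁆) (cong₂ _∨_ (lookup-⁅⁆ i g) (lookup-⁅⁆ j g))
  rearrange : ∀ s → 𝟙 (∣ s ∣ ≡ᵇ 3) * 𝟙 (lookup s i ∧ lookup s j ∧ p s) ≡ 𝟙 ((R ⊆ᵇ s) ∧ (∣ s ∣ ≡ᵇ suc ∣ R ∣)) * 𝟙 (p s)
  rearrange s rewrite ∣⁅i⁆∪⁅j⁆∣≡2 i j i≢j | ⊆ᵇ-∪ ⁅ i ⁆ ⁅ j ⁆ s | ⁅⁆-⊆ᵇ i s | ⁅⁆-⊆ᵇ j s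
    with lookup s i | lookup s j | ∣ s ∣ ≡ᵇ 3
  ... | false | _     | false = refl
  ... | false | _     | true  = refl
  ... | true  | false | false = refl
  ... | true  | false | true  = refl
  ... | true  | true  | _     = refl

pairSummand : {n : ℕ} → Colouring n → Fin n → Fin n → Fin n → ℕ
pairSummand col x y g = 𝟙 (not (does (x ≟ᶠ g) ∨ does (y ≟ᶠ g))) * 𝟙 (bar col x y g)

barPair≡∑ : {n : ℕ} (col : Colouring n) {x y : Fin n} → x ≢ y →
  barPair col x y ≡ ∑[ g < n ] pairSummand col x y g
barPair≡∑ {n} col {x} {y} x≢y = count-triples-through-pair n x y x≢y col

∑-off-two-points : (n : ℕ) (P : Fin n → ℕ) (u w : Fin n) →
  ∑[ g < n ] (P g + δ u g + δ w g) ≡ ∑ P + 1 + 1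
∑-off-two-points n P u w =
  trans (∑-distrib-+ (λ g → P g + δ u g) (δ w))
        (cong₂ _+_ (trans (∑-distrib-+ P (δ u)) (cong (λ t → ∑ P + t) (∑-δ-one n u))) (∑-δ-one n w))

barPair+2≤n : {n : ℕ} (col : Colouring n) {x y : Fin n} → x ≢ y → barPair col x y + 1 + 1 ≤ n
barPair+2≤n {n} col {x} {y} x≢y = begin
  barPair col x y + 1 + 1
    ≡⟨ cong (λ t → t + 1 + 1) (barPair≡∑ col x≢y) ⟩
  ∑ (pairSummand col x y) + 1 + 1
    ≤⟨ ℕ.+-monoˡ-≤ 1 (ℕ.+-monoˡ-≤ 1 (∑-mono-≤ n (λ g → 𝟙*𝟙≤𝟙 (off-pair g) (bar col x y g)))) ⟩
  ∑ (𝟙 ∘ off-pair) + 1 + 1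
    ≡⟨ ∑-off-two-points n (𝟙 ∘ off-pair) x y ⟨
  ∑[ g < n ] (𝟙 (off-pair g) + δ x g + δ y g)
    ≡⟨ sum-cong-≗ {n} (λ g → 𝟙-partition _ _ (δ-exclusive x≢y g)) ⟩
  ∑[ g < n ] 1
    ≡⟨ ∑-const-one n ⟩
  n ∎
  where
  open ℕ.≤-Reasoning
  off-pair : Fin n → Bool
  off-pair g = not (does (x ≟ᶠ g) ∨ does (y ≟ᶠ g))

barPair-cong : {n : ℕ} (col : Colouring n) {x y x′ y′ u v u′ v′ : Fin n} → x ≢ y → x′ ≢ y′ →
  (∀ g → pairSummand col x y g + δ u g + δ v g ≡ pairSummand col x′ y′ g + δ u′ g + δ v′ g) →
  barPair col x y ≡ barPair col x′ y′
barPair-cong {n} col {x} {y} {x′} {y′} {u} {v} {u′} {v′} x≢y x′≢y′ summands≡ =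
  +-cancelʳ-≡ 1 _ _ (+-cancelʳ-≡ 1 _ _ (begin
    barPair col x y + 1 + 1        ≡⟨ cong (λ t → t + 1 + 1) (barPair≡∑ col x≢y) ⟩
    ∑ (pairSummand col x y) + 1 + 1 ≡⟨ ∑-off-two-points n _ u v ⟨
    ∑[ g < n ] (pairSummand col x y g + δ u g + δ v g)     ≡⟨ sum-cong-≗ {n} summands≡ ⟩
    ∑[ g < n ] (pairSummand col x′ y′ g + δ u′ g + δ v′ g) ≡⟨ ∑-off-two-points n _ u′ v′ ⟩
    ∑ (pairSummand col x′ y′) + 1 + 1 ≡⟨ cong (λ t → t + 1 + 1) (barPair≡∑ col x′≢y′) ⟨
    barPair col x′ y′ + 1 + 1 ∎))
  where open ≡-Reasoning

triple : {n : ℕ} → Fin n → Fin n → Fin n → Subset n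
triple x y z = ⁅ x ⁆ ∪ ⁅ y ⁆ ∪ ⁅ z ⁆

lookup-triple : {n : ℕ} (x y z g : Fin n) →
  lookup (triple x y z) g ≡ does (x ≟ᶠ g) ∨ does (y ≟ᶠ g) ∨ does (z ≟ᶠ g)
lookup-triple x y z g = begin
  lookup (triple x y z) g                          ≡⟨ lookup-zipWith _∨_ g ⁅ x ⁆ (⁅ y ⁆ ∪ ⁅ z ⁆) ⟩
  lookup ⁅ x ⁆ g ∨ lookup (⁅ y ⁆ ∪ ⁅ z ⁆) g         ≡⟨ cong (lookup ⁅ x ⁆ g ∨_) (lookup-zipWith _∨_ g ⁅ y ⁆ ⁅ z ⁆) ⟩
  lookup ⁅ x ⁆ g ∨ lookup ⁅ y ⁆ g ∨ lookup ⁅ z ⁆ g ≡⟨ cong₂ _∨_ (lookup-⁅⁆ x g) (cong₂ _∨_ (lookup-⁅⁆ y g) (lookup-⁅⁆ z g)) ⟩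
  does (x ≟ᶠ g) ∨ does (y ≟ᶠ g) ∨ does (z ≟ᶠ g) ∎
  where open ≡-Reasoning

∣∩triple∣ : {n : ℕ} {x y z : Fin n} → Distinct3 x y z → (u : Subset n) →
  ∣ u ∩ triple x y z ∣ ≡ 𝟙 (lookup u x) + 𝟙 (lookup u y) + 𝟙 (lookup u z)
∣∩triple∣ {n} {x} {y} {z} (x≢y , x≢z , y≢z) u = begin
  ∣ u ∩ triple x y z ∣
    ≡⟨ ∣∣≡∑ (u ∩ triple x y z) ⟩
  ∑[ g < n ] 𝟙 (lookup (u ∩ triple x y z) g)
    ≡⟨ sum-cong-≗ {n} pointwise ⟩
  ∑[ g < n ] (δ x g * 𝟙 (lookup u g) + δ y g * 𝟙 (lookup u g) + δ z g * 𝟙 (lookup u g))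
    ≡⟨ ∑-distrib-+ (λ g → δ x g * 𝟙 (lookup u g) + δ y g * 𝟙 (lookup u g)) _ ⟩
  _ ≡⟨ cong (_+ _) (∑-distrib-+ (λ g → δ x g * 𝟙 (lookup u g)) _) ⟩
  _ ≡⟨ cong₂ _+_ (cong₂ _+_ (∑-δ n x _) (∑-δ n y _)) (∑-δ n z _) ⟩
  𝟙 (lookup u x) + 𝟙 (lookup u y) + 𝟙 (lookup u z) ∎
  where
  open ≡-Reasoning
  pointwise : ∀ g → 𝟙 (lookup (u ∩ triple x y z) g) ≡
    δ x g * 𝟙 (lookup u g) + δ y g * 𝟙 (lookup u g) + δ z g * 𝟙 (lookup u g)
  pointwise g = begin
    𝟙 (lookup (u ∩ triple x y z) g)
      ≡⟨ cong 𝟙 (trans (lookup-zipWith _∧_ g u (triple x y z)) (Boolₚ.∧-comm (lookup u g) _)) ⟩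
    𝟙 (lookup (triple x y z) g ∧ lookup u g)
      ≡⟨ 𝟙-∧ _ (lookup u g) ⟩
    𝟙 (lookup (triple x y z) g) * 𝟙 (lookup u g)
      ≡⟨ cong (λ t → 𝟙 t * 𝟙 (lookup u g)) (lookup-triple x y z g) ⟩
    𝟙 (does (x ≟ᶠ g) ∨ does (y ≟ᶠ g) ∨ does (z ≟ᶠ g)) * 𝟙 (lookup u g)
      ≡⟨ cong (_* 𝟙 (lookup u g)) (𝟙-∨-disjoint _ _ x-excludes) ⟩
    (δ x g + 𝟙 (does (y ≟ᶠ g) ∨ does (z ≟ᶠ g))) * 𝟙 (lookup u g)
      ≡⟨ cong (λ t → (δ x g + t) * 𝟙 (lookup u g)) (𝟙-∨-disjoint _ _ (δ-exclusive y≢z g)) ⟩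
    (δ x g + (δ y g + δ z g)) * 𝟙 (lookup u g)
      ≡⟨ distribute (δ x g) (δ y g) (δ z g) (𝟙 (lookup u g)) ⟩
    δ x g * 𝟙 (lookup u g) + δ y g * 𝟙 (lookup u g) + δ z g * 𝟙 (lookup u g) ∎
    where
    x-excludes : does (x ≟ᶠ g) ≡ true → does (y ≟ᶠ g) ∨ does (z ≟ᶠ g) ≡ false
    x-excludes x≡g = cong₂ _∨_ (δ-exclusive x≢y g x≡g) (δ-exclusive x≢z g x≡g)
    distribute : ∀ a b c w → (a + (b + c)) * w ≡ a * w + b * w + c * w
    distribute = solve-∀

∣triple∣≡3 : {n : ℕ} {x y z : Fin n} → Distinct3 x y z → ∣ triple x y z ∣ ≡ 3
∣triple∣≡3 {x = x} {y} {z} distinct = begin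
  ∣ triple x y z ∣     ≡⟨ cong ∣_∣ (∩-identityˡ (triple x y z)) ⟨
  ∣ ⊤ ∩ triple x y z ∣ ≡⟨ ∣∩triple∣ distinct ⊤ ⟩
  𝟙 (lookup ⊤ x) + 𝟙 (lookup ⊤ y) + 𝟙 (lookup ⊤ z)
    ≡⟨ cong₂ _+_ (cong₂ _+_ (cong 𝟙 (lookup-replicate x inside)) (cong 𝟙 (lookup-replicate y inside))) (cong 𝟙 (lookup-replicate z inside)) ⟩
  3 ∎
  where open ≡-Reasoning

count-supersets-of-triple : {n : ℕ} (col : Colouring n) {x y z : Fin n} → Distinct3 x y z →
  count (λ s → lookup s x ∧ lookup s y ∧ (lookup s z ∧ col s)) (vertices n) ≡ 𝟙 (bar col x y z)
count-supersets-of-triple {n} col {x} {y} {z} (x≢y , x≢z , y≢z) =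
  trans (count-triples-through-pair n x y x≢y (λ s → lookup s z ∧ col s))
        (trans (sum-cong-≗ {n} only-z) (∑-δ n z (λ g → 𝟙 (bar col x y g))))
  where
  only-z : ∀ g → 𝟙 (not (does (x ≟ᶠ g) ∨ does (y ≟ᶠ g))) * 𝟙 (lookup (triple x y g) z ∧ bar col x y g) ≡
                 δ z g * 𝟙 (bar col x y g)
  only-z g rewrite lookup-triple x y g z | dec-false (x ≟ᶠ z) x≢z | dec-false (y ≟ᶠ z) y≢z with g ≟ᶠ z
  ... | yes refl rewrite dec-false (x ≟ᶠ g) x≢z | dec-false (y ≟ᶠ g) y≢z | dec-true (g ≟ᶠ g) refl = refl
  ... | no g≢z   rewrite dec-false (z ≟ᶠ g) (g≢z ∘ sym) = ℕ.*-zeroʳ (𝟙 (not (does (x ≟ᶠ g) ∨ does (y ≟ᶠ g))))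

-- A 3-subset u is adjacent to v = {x,y,z} iff it contains exactly two of x, y, z; v itself contains all
-- three, so it is counted once by each of xy∗, xz∗, yz∗.
meets-in-two : (a b c w : Bool) →
  𝟙 ((𝟙 a + 𝟙 b + 𝟙 c ≡ᵇ 2) ∧ w) + 3 * 𝟙 (a ∧ b ∧ (c ∧ w)) ≡ 𝟙 (a ∧ b ∧ w) + 𝟙 (a ∧ c ∧ w) + 𝟙 (b ∧ c ∧ w)
meets-in-two true  true  true  true  = refl
meets-in-two true  true  true  false = refl
meets-in-two true  true  false true  = refl
meets-in-two true  true  false false = refl
meets-in-two true  false true  true  = refl
meets-in-two true  false true  false = refl
meets-in-two true  false false true  = refl
meets-in-two true  false false false = refl
meets-in-two false true  true  true  = refl
meets-in-two false true  true  false = refl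
meets-in-two false true  false true  = refl
meets-in-two false true  false false = refl
meets-in-two false false true  true  = refl
meets-in-two false false true  false = refl
meets-in-two false false false true  = refl
meets-in-two false false false false = refl

nbrs₁+3·bar≡pairSum : {n : ℕ} (col : Colouring n) {x y z : Fin n} → Distinct3 x y z →
  nbrs₁ col (triple x y z) + 3 * 𝟙 (bar col x y z) ≡ barPair col x y + barPair col x z + barPair col y z
nbrs₁+3·bar≡pairSum {n} col {x} {y} {z} distinct = begin
  nbrs₁ col v + 3 * 𝟙 (bar col x y z)
    ≡⟨ cong₂ (λ k l → k + 3 * l) (count≡∑ᴸ _ V)
             (trans (sym (count-supersets-of-triple col distinct)) (count≡∑ᴸ _ V)) ⟩
  ∑ᴸ adjN V + 3 * ∑ᴸ vN V
    ≡⟨ cong (λ t → ∑ᴸ adjN V + t) (∑ᴸ-*ˡ 3 vN V) ⟨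
  ∑ᴸ adjN V + ∑ᴸ (λ u → 3 * vN u) V
    ≡⟨ ∑ᴸ-distrib-+ adjN (λ u → 3 * vN u) V ⟨
  ∑ᴸ (λ u → adjN u + 3 * vN u) V
    ≡⟨ ∑ᴸ-cong V pointwise ⟩
  ∑ᴸ (λ u → pairN x y u + pairN x z u + pairN y z u) V
    ≡⟨ ∑ᴸ-distrib-+ (λ u → pairN x y u + pairN x z u) (pairN y z) V ⟩
  ∑ᴸ (λ u → pairN x y u + pairN x z u) V + ∑ᴸ (pairN y z) V
    ≡⟨ cong (_+ ∑ᴸ (pairN y z) V) (∑ᴸ-distrib-+ (pairN x y) (pairN x z) V) ⟩
  ∑ᴸ (pairN x y) V + ∑ᴸ (pairN x z) V + ∑ᴸ (pairN y z) V
    ≡⟨ cong₂ _+_ (cong₂ _+_ (count≡∑ᴸ _ V) (count≡∑ᴸ _ V)) (count≡∑ᴸ _ V) ⟨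
  barPair col x y + barPair col x z + barPair col y z ∎
  where
  open ≡-Reasoning
  v : Subset n
  v = triple x y z
  V : List (Subset n)
  V = vertices n
  adjN vN : Subset n → ℕ
  adjN u = 𝟙 (adjacent u v ∧ col u)
  vN u = 𝟙 (lookup u x ∧ lookup u y ∧ (lookup u z ∧ col u))
  pairN : Fin n → Fin n → Subset n → ℕ
  pairN i j u = 𝟙 (lookup u i ∧ lookup u j ∧ col u)
  pointwise : ∀ u → adjN u + 3 * vN u ≡ pairN x y u + pairN x z u + pairN y z u
  pointwise u = begin
    𝟙 (adjacent u v ∧ col u) + 3 * vN u
      ≡⟨ cong (λ b → 𝟙 (b ∧ col u) + 3 * vN u) (isYes≗does (∣ u ∩ v ∣ ≟ 2)) ⟩
    𝟙 ((∣ u ∩ v ∣ ≡ᵇ 2) ∧ col u) + 3 * vN u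
      ≡⟨ cong (λ k → 𝟙 ((k ≡ᵇ 2) ∧ col u) + 3 * vN u) (∣∩triple∣ distinct u) ⟩
    _ ≡⟨ meets-in-two (lookup u x) (lookup u y) (lookup u z) (col u) ⟩
    pairN x y u + pairN x z u + pairN y z u ∎

module _ {n : ℕ} {col : Colouring n} {p11 p12 p21 p22 : ℕ} (E : Equitable col p11 p12 p21 p22)
         {x y z : Fin n} (distinct : Distinct3 x y z) where

  X₁-rowSum : bar col x y z ≡ true → p11 + 3 ≡ barPair col x y + barPair col x z + barPair col y z
  X₁-rowSum xyz∈X₁ = begin
    p11 + 3                                   ≡⟨ cong₂ (λ k b → k + 3 * 𝟙 b) nbrs₁≡p11 xyz∈X₁ ⟨
    nbrs₁ col (triple x y z) + 3 * 𝟙 (bar col x y z) ≡⟨ nbrs₁+3·bar≡pairSum col distinct ⟩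
    barPair col x y + barPair col x z + barPair col y z ∎
    where
    open ≡-Reasoning
    nbrs₁≡p11 : nbrs₁ col (triple x y z) ≡ p11
    nbrs₁≡p11 = proj₁ (Equitable.row₁ E (triple x y z) (∣triple∣≡3 distinct) xyz∈X₁)

  X₂-rowSum : bar col x y z ≡ false → p21 ≡ barPair col x y + barPair col x z + barPair col y z
  X₂-rowSum xyz∈X₂ = begin
    p21                                       ≡⟨ +-identityʳ p21 ⟨
    p21 + 3 * 0                                ≡⟨ cong₂ (λ k b → k + 3 * 𝟙 b) nbrs₁≡p21 xyz∈X₂ ⟨
    nbrs₁ col (triple x y z) + 3 * 𝟙 (bar col x y z) ≡⟨ nbrs₁+3·bar≡pairSum col distinct ⟩
    barPair col x y + barPair col x z + barPair col y z ∎
    where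
    open ≡-Reasoning
    nbrs₁≡p21 : nbrs₁ col (triple x y z) ≡ p21
    nbrs₁≡p21 = proj₁ (Equitable.row₂ E (triple x y z) (∣triple∣≡3 distinct) xyz∈X₂)

bar-swap₂₃ : {n : ℕ} (col : Colouring n) (x y z : Fin n) → bar col x z y ≡ bar col x y z
bar-swap₂₃ col x y z = cong (λ t → col (⁅ x ⁆ ∪ t)) (∪-comm ⁅ z ⁆ ⁅ y ⁆)

bar-rotate : {n : ℕ} (col : Colouring n) (x y z : Fin n) → bar col y z x ≡ bar col x y z
bar-rotate col x y z = cong col (trans (sym (∪-assoc ⁅ y ⁆ ⁅ z ⁆ ⁅ x ⁆)) (∪-comm (⁅ y ⁆ ∪ ⁅ z ⁆) ⁅ x ⁆))

module Configuration {n : ℕ} (col : Colouring n) {a b c d e f : Fin n}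
  (a≢b : a ≢ b) (a≢c : a ≢ c) (b≢c : b ≢ c) (abc : bar col a b c ≡ true)
  (d≢e : d ≢ e) (d≢f : d ≢ f) (e≢f : e ≢ f)
  (d≢a : d ≢ a) (d≢b : d ≢ b) (d≢c : d ≢ c)
  (e≢a : e ≢ a) (e≢b : e ≢ b) (e≢c : e ≢ c)
  (f≢a : f ≢ a) (f≢b : f ≢ b) (f≢c : f ≢ c)
  (abd : bar col a b d ≡ true)  (acd : bar col a c d ≡ true)  (bcd : bar col b c d ≡ false)
  (abe : bar col a b e ≡ true)  (ace : bar col a c e ≡ false) (bce : bar col b c e ≡ true)
  (abf : bar col a b f ≡ false) (acf : bar col a c f ≡ true)  (bcf : bar col b c f ≡ true)
  (others : ∀ g → g ≢ a → g ≢ b → g ≢ c → g ≢ d → g ≢ e → g ≢ f →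
    (bar col a b g ≡ true × bar col a c g ≡ true × bar col b c g ≡ true) ⊎
    (bar col a b g ≡ false × bar col a c g ≡ false × bar col b c g ≡ false))
  where

  private
    ≢⇒does : {x y : Fin n} → x ≢ y → does (x ≟ᶠ y) ≡ false
    ≢⇒does {x} {y} = dec-false (x ≟ᶠ y)

    does-refl : (x : Fin n) → does (x ≟ᶠ x) ≡ true
    does-refl x = dec-true (x ≟ᶠ x) refl

  ab∗-ac∗-summands : ∀ g → pairSummand col a b g + δ b g + δ f g ≡ pairSummand col a c g + δ c g + δ e g
  ab∗-ac∗-summands g with g ≟ᶠ a
  ... | yes refl rewrite does-refl g | ≢⇒does (a≢b ∘ sym) | ≢⇒does f≢a | ≢⇒does (a≢c ∘ sym) | ≢⇒does e≢a = refl
  ... | no g≢a with g ≟ᶠ b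
  ... | yes refl rewrite does-refl g | ≢⇒does a≢b | ≢⇒does f≢b | ≢⇒does (b≢c ∘ sym) | ≢⇒does e≢b
                       | bar-swap₂₃ col a g c | abc = refl
  ... | no g≢b with g ≟ᶠ c
  ... | yes refl rewrite does-refl g | ≢⇒does a≢c | ≢⇒does b≢c | ≢⇒does f≢c | ≢⇒does e≢c | abc = refl
  ... | no g≢c with g ≟ᶠ d
  ... | yes refl rewrite ≢⇒does (d≢a ∘ sym) | ≢⇒does (d≢b ∘ sym) | ≢⇒does (d≢c ∘ sym)
                       | ≢⇒does (d≢f ∘ sym) | ≢⇒does (d≢e ∘ sym) | abd | acd = refl
  ... | no g≢d with g ≟ᶠ e
  ... | yes refl rewrite does-refl g | ≢⇒does (e≢a ∘ sym) | ≢⇒does (e≢b ∘ sym) | ≢⇒does (e≢c ∘ sym)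
                       | ≢⇒does (e≢f ∘ sym) | abe | ace = refl
  ... | no g≢e with g ≟ᶠ f
  ... | yes refl rewrite does-refl g | ≢⇒does (f≢a ∘ sym) | ≢⇒does (f≢b ∘ sym) | ≢⇒does (f≢c ∘ sym)
                       | ≢⇒does e≢f | abf | acf = refl
  ... | no g≢f rewrite ≢⇒does (g≢a ∘ sym) | ≢⇒does (g≢b ∘ sym) | ≢⇒does (g≢c ∘ sym)
                     | ≢⇒does (g≢e ∘ sym) | ≢⇒does (g≢f ∘ sym) with others g g≢a g≢b g≢c g≢d g≢e g≢f
  ... | inj₁ (abg , acg , _) rewrite abg | acg = refl
  ... | inj₂ (abg , acg , _) rewrite abg | acg = refl

  ab∗-bc∗-summands : ∀ g → pairSummand col a b g + δ a g + δ f g ≡ pairSummand col b c g + δ c g + δ d g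
  ab∗-bc∗-summands g with g ≟ᶠ a
  ... | yes refl rewrite does-refl g | ≢⇒does (a≢b ∘ sym) | ≢⇒does f≢a | ≢⇒does (a≢c ∘ sym) | ≢⇒does d≢a
                       | bar-rotate col g b c | abc = refl
  ... | no g≢a with g ≟ᶠ b
  ... | yes refl rewrite does-refl g | ≢⇒does a≢b | ≢⇒does f≢b | ≢⇒does (b≢c ∘ sym) | ≢⇒does d≢b = refl
  ... | no g≢b with g ≟ᶠ c
  ... | yes refl rewrite does-refl g | ≢⇒does a≢c | ≢⇒does b≢c | ≢⇒does f≢c | ≢⇒does d≢c | abc = refl
  ... | no g≢c with g ≟ᶠ d
  ... | yes refl rewrite does-refl g | ≢⇒does (d≢a ∘ sym) | ≢⇒does (d≢b ∘ sym) | ≢⇒does (d≢c ∘ sym)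
                       | ≢⇒does (d≢f ∘ sym) | abd | bcd = refl
  ... | no g≢d with g ≟ᶠ e
  ... | yes refl rewrite ≢⇒does (e≢a ∘ sym) | ≢⇒does (e≢b ∘ sym) | ≢⇒does (e≢c ∘ sym)
                       | ≢⇒does (e≢f ∘ sym) | ≢⇒does d≢e | abe | bce = refl
  ... | no g≢e with g ≟ᶠ f
  ... | yes refl rewrite does-refl g | ≢⇒does (f≢a ∘ sym) | ≢⇒does (f≢b ∘ sym) | ≢⇒does (f≢c ∘ sym)
                       | ≢⇒does d≢f | abf | bcf = refl
  ... | no g≢f rewrite ≢⇒does (g≢a ∘ sym) | ≢⇒does (g≢b ∘ sym) | ≢⇒does (g≢c ∘ sym)
                     | ≢⇒does (g≢d ∘ sym) | ≢⇒does (g≢f ∘ sym) with others g g≢a g≢b g≢c g≢d g≢e g≢f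
  ... | inj₁ (abg , _ , bcg) rewrite abg | bcg = refl
  ... | inj₂ (abg , _ , bcg) rewrite abg | bcg = refl

  ab∗≡ac∗ : barPair col a b ≡ barPair col a c
  ab∗≡ac∗ = barPair-cong col {u = b} {v = f} {u′ = c} {v′ = e} a≢b a≢c ab∗-ac∗-summands

  ab∗≡bc∗ : barPair col a b ≡ barPair col b c
  ab∗≡bc∗ = barPair-cong col {u = a} {v = f} {u′ = c} {v′ = d} a≢b b≢c ab∗-bc∗-summands

n≤8-from-rowSums : {n p q A B C AD BD CD : ℕ} →
  p + 3 ≡ A + B + C → p + 3 ≡ A + AD + BD → p + 3 ≡ B + AD + CD → q ≡ C + BD + CD → A ≡ B → A ≡ C →
  p + 7 ≡ n + q → 2 * n ≤ p + 7 → AD + 1 + 1 ≤ n → n ≤ 8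
n≤8-from-rowSums {n} {p} {q} {A} {_} {_} {AD} {BD} {CD} abc abd acd bcd refl refl p+7≡n+q 2n≤p+7 AD+2≤n =
  ℕ.+-cancelʳ-≤ 6 n 8 (ℕ.+-cancelˡ-≤ (6 * n) (n + 6) 14 (begin
    6 * n + (n + 6)           ≡⟨ split-7n n ⟩
    2 * (2 * n) + (3 * n + 6) ≤⟨ ℕ.+-monoˡ-≤ (3 * n + 6) (ℕ.*-monoʳ-≤ 2 2n≤p+7) ⟩
    2 * (p + 7) + (3 * n + 6) ≡⟨ regroup p n ⟩
    (2 * p + 3 * n + 6) + 14  ≡⟨ cong (_+ 14) key ⟩
    6 * (AD + 1 + 1) + 14     ≤⟨ ℕ.+-monoˡ-≤ 14 (ℕ.*-monoʳ-≤ 6 AD+2≤n) ⟩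
    6 * n + 14 ∎))
  where
  open ℕ.≤-Reasoning
  split-7n : ∀ n → 6 * n + (n + 6) ≡ 2 * (2 * n) + (3 * n + 6)
  split-7n = solve-∀
  regroup : ∀ p n → 2 * (p + 7) + (3 * n + 6) ≡ (2 * p + 3 * n + 6) + 14
  regroup = solve-∀
  sum₁ sum₂ : ℕ
  sum₁ = 3 * (p + 3) + 3 * (p + 3) + 3 * (A + BD + CD) + (A + A + A) + 3 * (n + q)
  sum₂ = 3 * (A + AD + BD) + 3 * (A + AD + CD) + 3 * q + (p + 3) + 3 * (p + 7)
  -- The hypotheses weighted 1, 3, 3, 3, 3, each side placed so that no subtraction occurs.
  sum₁≡sum₂ : sum₁ ≡ sum₂
  sum₁≡sum₂ rewrite abd | acd | sym bcd | abc | p+7≡n+q = refl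
  key : 2 * p + 3 * n + 6 ≡ 6 * (AD + 1 + 1)
  key = +-cancelʳ-≡ sum₂ _ _ (trans (weighted-sum p q n A AD BD CD) (cong (λ t → 6 * (AD + 1 + 1) + t) sum₁≡sum₂))
    where
    weighted-sum : ∀ p q n A AD BD CD →
      (2 * p + 3 * n + 6) + (3 * (A + AD + BD) + 3 * (A + AD + CD) + 3 * q + (p + 3) + 3 * (p + 7)) ≡
      6 * (AD + 1 + 1) + (3 * (p + 3) + 3 * (p + 3) + 3 * (A + BD + CD) + (A + A + A) + 3 * (n + q))
    weighted-sum = solve-∀

ℤ-difference⇒ℕ : (m n k l : ℕ) → + m - + n ≡ + k - + l → m + l ≡ k + n
ℤ-difference⇒ℕ m n k l eq = ℤP.+-injective (begin
  + m ⊕ + l                 ≡⟨ shift (+ m) (+ n) (+ l) ⟩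
  (+ m - + n) ⊕ (+ n ⊕ + l) ≡⟨ cong (_⊕ (+ n ⊕ + l)) eq ⟩
  (+ k - + l) ⊕ (+ n ⊕ + l) ≡⟨ unshift (+ k) (+ n) (+ l) ⟩
  + k ⊕ + n ∎)
  where
  open ≡-Reasoning
  shift : ∀ a b c → a ⊕ c ≡ (a - b) ⊕ (b ⊕ c)
  shift = ℤ-solve-∀
  unshift : ∀ a b c → (a - c) ⊕ (b ⊕ c) ≡ a ⊕ b
  unshift = ℤ-solve-∀

ℤ-≥-difference⇒ℕ : (m k l : ℕ) → + m ℤ.≥ + k - + l → k ≤ m + l
ℤ-≥-difference⇒ℕ m k l m≥k-l = ℤP.drop‿+≤+ (subst (ℤ._≤ + m ⊕ + l) (cancel (+ k) (+ l)) (ℤP.+-monoˡ-≤ (+ l) m≥k-l))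
  where
  cancel : ∀ a c → (a - c) ⊕ c ≡ a
  cancel = ℤ-solve-∀

mainTheorem19 :
    (n : ℕ) (col : Colouring n) (p11 p12 p21 p22 : ℕ) →
    Equitable col p11 p12 p21 p22 →
    LambdaTwo n p11 p21 →
    p11 ≥ p22 →
    ℤ._≥_ (+ p11) ((+ (2 Data.Nat.* n)) - (+ 7)) →
    (∀ x y z → ¬ TypeI col x y z) →
    (∀ x y z → ¬ TypeII col x y z) →
    (a b c d e f : Fin n) →
    Distinct3 a b c →
    bar col a b c ≡ true →
    Distinct3 d e f →
    (d ≢ a × d ≢ b × d ≢ c) → (e ≢ a × e ≢ b × e ≢ c) → (f ≢ a × f ≢ b × f ≢ c) →
    (bar col a b d ≡ true × bar col a c d ≡ true × bar col b c d ≡ false) →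
    (bar col a b e ≡ true × bar col a c e ≡ false × bar col b c e ≡ true) →
    (bar col a b f ≡ false × bar col a c f ≡ true × bar col b c f ≡ true) →
    (∀ g → g ≢ a → g ≢ b → g ≢ c → g ≢ d → g ≢ e → g ≢ f →
      (bar col a b g ≡ true × bar col a c g ≡ true × bar col b c g ≡ true) ⊎
      (bar col a b g ≡ false × bar col a c g ≡ false × bar col b c g ≡ false)) →
    n ≤ 8
mainTheorem19 n col p11 p12 p21 p22 E λ₂ _ p11≥2n-7 _ _ a b c d e f
  abc-distinct@(a≢b , a≢c , b≢c) abc (d≢e , d≢f , e≢f) (d≢a , d≢b , d≢c) (e≢a , e≢b , e≢c) (f≢a , f≢b , f≢c)
  (abd , acd , bcd) (abe , ace , bce) (abf , acf , bcf) others =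
  n≤8-from-rowSums
    (X₁-rowSum E abc-distinct abc)
    (X₁-rowSum E (a≢b , d≢a ∘ sym , d≢b ∘ sym) abd)
    (X₁-rowSum E (a≢c , d≢a ∘ sym , d≢c ∘ sym) acd)
    (X₂-rowSum E (b≢c , d≢b ∘ sym , d≢c ∘ sym) bcd)
    ab∗≡ac∗ ab∗≡bc∗
    (ℤ-difference⇒ℕ p11 p21 n 7 λ₂)
    (ℤ-≥-difference⇒ℕ p11 (2 * n) 7 p11≥2n-7)
    (barPair+2≤n col (d≢a ∘ sym))
  where
  open Configuration col a≢b a≢c b≢c abc d≢e d≢f e≢f d≢a d≢b d≢c e≢a e≢b e≢c f≢a f≢b f≢c
                     abd acd bcd abe ace bce abf acf bcf others
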